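{- Let $n>k\ge 1$ and let $H$ be a $k$-uniform hypergraph on the vertex set $[n]$ such that $\{i,i+1,\dots,i+k-1\}\in E(H)$ for all $1\le i\le n-k+1$. If $E(H)$ is transitive, then $H$ is the complete $k$-uniform hypergraph on $[n]$.
   Context: A family $\mathcal F$ of $k$-element subsets of $[n]$ is transitive if for all $i_1<\dots<i_{k+1}$ in $[n]$ with $\{i_1,\dots,i_k\},\{i_2,\dots,i_{k+1}\}\in\mathcal F$, every $k$-element subset of $\{i_1,\dots,i_{k+1}\}$ belongs to $\mathcal F$. -}

module Defs where

open import Data.Nat using (ℕ; suc; _+_; _≤_; _<_)
open import Data.Fin using (Fin; toℕ; inject₁) renaming (suc to fsuc)
open import Data.Fin.Subset using (Subset; _∈_; _⊆_; ∣_∣)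
open import Data.Product using (∃; _×_)
open import Relation.Binary.PropositionalEquality using (_≡_)

-- Vertex set [n] is modelled by Fin n (vertex v ∈ [n] ↔ v-1 ∈ Fin n).
record UniformHypergraph (n k : ℕ) : Set₁ where
  field
    Edge    : Subset n → Set
    uniform : ∀ S → Edge S → ∣ S ∣ ≡ k
open UniformHypergraph public

image : ∀ {m n} → (Fin m → Fin n) → Subset n → Set
image {m} f S = ∀ v → v ∈ S → ∃ λ j → f j ≡ v

IsImage : ∀ {m n} → (Fin m → Fin n) → Subset n → Set
IsImage {m} f S = (∀ j → f j ∈ S) × image f S

StrictlyIncreasing : ∀ {m n} → (Fin m → Fin n) → Set
StrictlyIncreasing {m} f = ∀ (a b : Fin m) → toℕ a < toℕ b → toℕ (f a) < toℕ (f b)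

-- Transitivity of a family of k-subsets of [n]:
-- for i₁ < … < i_{k+1} with {i₁..i_k} and {i₂..i_{k+1}} in F,
-- every k-subset of {i₁..i_{k+1}} is in F.
Transitive : ∀ {n} (k : ℕ) → (Subset n → Set) → Set
Transitive {n} k F =
  ∀ (i : Fin (suc k) → Fin n) → StrictlyIncreasing i →
  ∀ (A B : Subset n) →
    IsImage (λ j → i (inject₁ j)) A → F A →
    IsImage (λ j → i (fsuc j)) B → F B →
    ∀ (S : Subset n) → ∣ S ∣ ≡ k → (∀ v → v ∈ S → ∃ λ j → i j ≡ v) → F S

-- The interval {a, a+1, …, a+k-1} (0-indexed vertices).
Interval : ∀ {n} → ℕ → ℕ → Subset n → Set
Interval {n} a k S = ∀ (v : Fin n) → (v ∈ S → a ≤ toℕ v × toℕ v < a + k)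
                                   × (a ≤ toℕ v × toℕ v < a + k → v ∈ S)

Complete : ∀ {n k} → UniformHypergraph n k → Set
Complete {n} {k} H = ∀ (S : Subset n) → ∣ S ∣ ≡ k → Edge H S

module Submission where

-- Write a k-set S (k = m + 1) as s₀ < s₁ < … < s_m and induct on its span
-- s_m − s₀.  If S has no gap (s_m = s₀ + m) it is an interval, hence an edge
-- by hypothesis.  Otherwise some x = s_t + 1 lies strictly between s_t and
-- s_{t+1}.  Inserting x gives an increasing (k+1)-tuple i₀ < … < i_k with
-- i₀ = s₀ and i_k = s_m, whose first k and last k entries form k-sets of
-- strictly smaller span, hence edges by induction.  Transitivity then puts
-- every k-subset of {i₀, …, i_k}, in particular S, into E(H).

open import Defs
open import Data.Nat using (ℕ; zero; suc; _+_; _∸_; _≤_; _<_; z≤n; s≤s; s≤s⁻¹; _≤?_)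
open import Data.Nat.Properties
open import Data.Nat.DivMod using (_mod_; m<n⇒m%n≡m)
open import Data.Nat.Induction using (<-rec)
open import Data.Fin using (Fin; toℕ; fromℕ<) renaming (zero to fzero; suc to fsuc)
open import Data.Fin.Properties using (toℕ-fromℕ<; toℕ-injective; toℕ-inject₁; toℕ<n)
open import Data.Fin.Subset using (Subset; _∈_; _∉_; ∣_∣; inside; outside; _∪_; ⁅_⁆; _-_)
open import Data.Fin.Subset.Properties
  using (x∈⁅y⁆⇒x≡y; x∈⁅x⁆; x∈p∪q⁺; x∈p∪q⁻; x∈p∧x≢y⇒x∈p-y; p─q⊆p; p─⊥≡p; ∪-identityʳ)
open import Data.Vec using ([]; _∷_; here; there)
open import Data.Product using (∃; _×_; _,_; proj₂)
open import Data.Sum using (_⊎_; inj₁; inj₂)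
open import Function using (_∘_)
open import Relation.Nullary using (yes; no; contradiction)
open import Relation.Binary using (tri<; tri≈; tri>)
open import Relation.Binary.PropositionalEquality

Ascending : ℕ → (ℕ → ℕ) → Set
Ascending m f = ∀ j → j < m → f j < f (suc j)

module _ {m : ℕ} {f : ℕ → ℕ} (asc : Ascending m f) where

  ascending-< : ∀ {a b} → a < b → b ≤ m → f a < f b
  ascending-< {a} {suc b} a<1+b 1+b≤m with m≤n⇒m<n∨m≡n (s≤s⁻¹ a<1+b)
  ... | inj₂ refl = asc a 1+b≤m
  ... | inj₁ a<b  = <-trans (ascending-< a<b (<⇒≤ 1+b≤m)) (asc b 1+b≤m)

  ascending-≤ : ∀ {a b} → a ≤ b → b ≤ m → f a ≤ f b
  ascending-≤ a≤b b≤m with m≤n⇒m<n∨m≡n a≤b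
  ... | inj₂ refl = ≤-refl
  ... | inj₁ a<b  = <⇒≤ (ascending-< a<b b≤m)

  ascending-growth : ∀ a d → a + d ≤ m → f a + d ≤ f (a + d)
  ascending-growth a zero _ rewrite +-identityʳ a | +-identityʳ (f a) = ≤-refl
  ascending-growth a (suc d) a+1+d≤m rewrite +-suc a d | +-suc (f a) d =
    <-≤-trans (s≤s (ascending-growth a d (<⇒≤ a+1+d≤m))) (asc (a + d) a+1+d≤m)

  tight⇒consecutive : f m ≤ f 0 + m → ∀ j → j ≤ m → f j ≡ f 0 + j
  tight⇒consecutive tight j j≤m = ≤-antisym upper (ascending-growth 0 j j≤m)
    where
    j+rest : j + (m ∸ j) ≡ m
    j+rest = m+[n∸m]≡n j≤m
    upper : f j ≤ f 0 + j
    upper = +-cancelʳ-≤ (m ∸ j) (f j) (f 0 + j) (begin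
      f j + (m ∸ j)   ≤⟨ ascending-growth j (m ∸ j) (≤-reflexive j+rest) ⟩
      f (j + (m ∸ j)) ≡⟨ cong f j+rest ⟩
      f m             ≤⟨ tight ⟩
      f 0 + m         ≡⟨ cong (f 0 +_) j+rest ⟨
      f 0 + (j + (m ∸ j)) ≡⟨ +-assoc (f 0) j (m ∸ j) ⟨
      f 0 + j + (m ∸ j) ∎)
      where open ≤-Reasoning

gap-or-tight : ∀ (f : ℕ → ℕ) l → (∃ λ t → t < l × suc (f t) < f (suc t)) ⊎ f l ≤ f 0 + l
gap-or-tight f zero = inj₂ (m≤m+n (f 0) 0)
gap-or-tight f (suc l) with gap-or-tight f l
... | inj₁ (t , t<l , gap) = inj₁ (t , m<n⇒m<1+n t<l , gap)
... | inj₂ tight with f (suc l) ≤? suc (f l)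
...   | no jump = inj₁ (l , ≤-refl , ≰⇒> jump)
...   | yes step = inj₂ (begin
        f (suc l)     ≤⟨ step ⟩
        suc (f l)     ≤⟨ s≤s tight ⟩
        suc (f 0 + l) ≡⟨ +-suc (f 0) l ⟨
        f 0 + suc l   ∎)
  where open ≤-Reasoning

span : ℕ → (ℕ → ℕ) → ℕ
span m f = f m ∸ f 0

module _ {m : ℕ} {f : ℕ → ℕ} (asc : Ascending (suc m) f) where

  span-init : span m f < span (suc m) f
  span-init = ∸-monoˡ-< (asc m ≤-refl) (ascending-≤ asc z≤n (n≤1+n m))

  span-tail : span m (f ∘ suc) < span (suc m) f
  span-tail = ∸-monoʳ-< (asc 0 (s≤s z≤n)) (ascending-≤ asc (s≤s z≤n) ≤-refl)

insertAt : ∀ {A : Set} → ℕ → A → (ℕ → A) → ℕ → A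
insertAt zero    x g zero    = x
insertAt zero    x g (suc j) = g j
insertAt (suc p) x g zero    = g zero
insertAt (suc p) x g (suc j) = insertAt p x (g ∘ suc) j

module _ {A : Set} (x : A) where

  insertAt-below : ∀ {p j} (g : ℕ → A) → j < p → insertAt p x g j ≡ g j
  insertAt-below {suc p} {zero}  g _   = refl
  insertAt-below {suc p} {suc j} g j<p = insertAt-below (g ∘ suc) (s≤s⁻¹ j<p)

  insertAt-at : ∀ p (g : ℕ → A) → insertAt p x g p ≡ x
  insertAt-at zero    g = refl
  insertAt-at (suc p) g = insertAt-at p (g ∘ suc)

  insertAt-above : ∀ {p j} (g : ℕ → A) → p ≤ j → insertAt p x g (suc j) ≡ g j
  insertAt-above {zero}  g _   = refl
  insertAt-above {suc p} {suc j} g p≤j = insertAt-above (g ∘ suc) (s≤s⁻¹ p≤j)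

  insertAt-keeps : ∀ p (g : ℕ → A) j → ∃ λ J → J ≤ suc j × insertAt p x g J ≡ g j
  insertAt-keeps zero    g j       = suc j , ≤-refl , refl
  insertAt-keeps (suc p) g zero    = zero , z≤n , refl
  insertAt-keeps (suc p) g (suc j) with insertAt-keeps p (g ∘ suc) j
  ... | J , J≤1+j , eq = suc J , s≤s J≤1+j , eq

  insert-ascending : ∀ (key : A → ℕ) {m t} (g : ℕ → A) → Ascending m (key ∘ g) → t < m →
    key (g t) < key x → key x < key (g (suc t)) → Ascending (suc m) (key ∘ insertAt (suc t) x g)
  insert-ascending key {suc m} {zero} g asc _ below above = steps
    where
    steps : Ascending (suc (suc m)) (key ∘ insertAt 1 x g)
    steps zero          _       = below
    steps (suc zero)    _       = above
    steps (suc (suc j)) 2+j<2+m = asc (suc j) (s≤s⁻¹ 2+j<2+m)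
  insert-ascending key {suc m} {suc t} g asc t<m below above = steps
    where
    steps : Ascending (suc (suc m)) (key ∘ insertAt (suc (suc t)) x g)
    steps zero    _       = asc 0 (s≤s z≤n)
    steps (suc j) 1+j<2+m = insert-ascending key (g ∘ suc) (λ i i<m → asc (suc i) (s≤s i<m))
                              (s≤s⁻¹ t<m) below above j (s≤s⁻¹ 1+j<2+m)

size-remove : ∀ {n} (p : Subset n) {x} → x ∈ p → suc ∣ p - x ∣ ≡ ∣ p ∣
size-remove (inside ∷ p)  {fzero}  here      = cong (suc ∘ ∣_∣) (p─⊥≡p p)
size-remove (inside ∷ p)  {fsuc x} (there q) = cong suc (size-remove p q)
size-remove (outside ∷ p) {fsuc x} (there q) = size-remove p q

size-add : ∀ {n} (p : Subset n) {x} → x ∉ p → ∣ p ∪ ⁅ x ⁆ ∣ ≡ suc ∣ p ∣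
size-add (inside ∷ p)  {fzero}  x∉p = contradiction here x∉p
size-add (outside ∷ p) {fzero}  _   = cong (suc ∘ ∣_∣) (∪-identityʳ p)
size-add (inside ∷ p)  {fsuc x} x∉p = cong suc (size-add p (x∉p ∘ there))
size-add (outside ∷ p) {fsuc x} x∉p = size-add p (x∉p ∘ there)

x∉p-x : ∀ {n} {p : Subset n} {x} → x ∉ p - x
x∉p-x {p = _ ∷ p} {fsuc x} (there q) = x∉p-x q

record Enumerates {n} (m : ℕ) (g : ℕ → Fin n) (S : Subset n) : Set where
  field
    ascending : Ascending m (toℕ ∘ g)
    member    : ∀ j → j ≤ m → g j ∈ S
    onto      : ∀ v → v ∈ S → ∃ λ j → j ≤ m × g j ≡ v
open Enumerates

module _ {n m : ℕ} {g : ℕ → Fin n} where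

  enumerates⇒isImage : ∀ {S} → Enumerates m g S → IsImage (λ (j : Fin (suc m)) → g (toℕ j)) S
  enumerates⇒isImage en = (λ j → member en (toℕ j) (s≤s⁻¹ (toℕ<n j))) , covers
    where
    covers : ∀ v → v ∈ _ → ∃ λ (j : Fin (suc m)) → g (toℕ j) ≡ v
    covers v v∈S with onto en v v∈S
    ... | j , j≤m , gj≡v = fromℕ< (s≤s j≤m) , trans (cong g (toℕ-fromℕ< (s≤s j≤m))) gj≡v

  ascending⇒strictlyIncreasing : Ascending m (toℕ ∘ g) →
    StrictlyIncreasing (λ (j : Fin (suc m)) → g (toℕ j))
  ascending⇒strictlyIncreasing asc a b a<b = ascending-< asc a<b (s≤s⁻¹ (toℕ<n b))

  enumerated-interval : ∀ {S} → Enumerates m g S → toℕ (g m) ≤ toℕ (g 0) + m →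
    Interval (toℕ (g 0)) (suc m) S × toℕ (g 0) + suc m ≤ n
  enumerated-interval {S} en tight = (λ v → inside⇒bounds v , bounds⇒inside v) , fits
    where
    a = toℕ (g 0)
    consecutive : ∀ j → j ≤ m → toℕ (g j) ≡ a + j
    consecutive = tight⇒consecutive (ascending en) tight
    fits : a + suc m ≤ n
    fits = subst (_≤ n) (sym (trans (+-suc a m) (cong suc (sym (consecutive m ≤-refl)))))
             (toℕ<n (g m))
    inside⇒bounds : ∀ v → v ∈ S → a ≤ toℕ v × toℕ v < a + suc m
    inside⇒bounds v v∈S with onto en v v∈S
    ... | j , j≤m , refl rewrite consecutive j j≤m = m≤m+n a j , +-monoʳ-< a (s≤s j≤m)
    bounds⇒inside : ∀ v → a ≤ toℕ v × toℕ v < a + suc m → v ∈ S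
    bounds⇒inside v (a≤v , v<end) = subst (_∈ S) gj≡v (member en j j≤m)
      where
      j = toℕ v ∸ a
      a+j≡v : a + j ≡ toℕ v
      a+j≡v = m+[n∸m]≡n a≤v
      j≤m : j ≤ m
      j≤m = s≤s⁻¹ (+-cancelˡ-< a j (suc m) (subst (_< a + suc m) (sym a+j≡v) v<end))
      gj≡v : g j ≡ v
      gj≡v = toℕ-injective (trans (consecutive j j≤m) a+j≡v)

  between-not-member : ∀ {S t x} → Enumerates m g S → t < m →
    toℕ (g t) < toℕ x → toℕ x < toℕ (g (suc t)) → x ∉ S
  between-not-member {t = t} en t<m below above x∈S with onto en _ x∈S
  ... | j , j≤m , refl with j ≤? t
  ...   | yes j≤t = <⇒≱ below (ascending-≤ (ascending en) j≤t (<⇒≤ t<m))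
  ...   | no  j≰t = <⇒≱ above (ascending-≤ (ascending en) (≰⇒> j≰t) j≤m)

  enumerates-insert : ∀ {S t x} → Enumerates m g S → t < m →
    toℕ (g t) < toℕ x → toℕ x < toℕ (g (suc t)) →
    Enumerates (suc m) (insertAt (suc t) x g) (S ∪ ⁅ x ⁆)
  enumerates-insert {S} {t} {x} en t<m below above = record
    { ascending = insert-ascending x toℕ g (ascending en) t<m below above
    ; member    = member′
    ; onto      = onto′
    }
    where
    h = insertAt (suc t) x g
    member′ : ∀ j → j ≤ suc m → h j ∈ S ∪ ⁅ x ⁆
    member′ j j≤1+m with <-cmp j (suc t)
    ... | tri< j<1+t _ _ = subst (_∈ S ∪ ⁅ x ⁆) (sym (insertAt-below x g j<1+t))
                             (x∈p∪q⁺ (inj₁ (member en j (≤-trans (s≤s⁻¹ j<1+t) (<⇒≤ t<m)))))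
    ... | tri≈ _ refl _  = subst (_∈ S ∪ ⁅ x ⁆) (sym (insertAt-at x (suc t) g))
                             (x∈p∪q⁺ (inj₂ (x∈⁅x⁆ x)))
    member′ (suc j) 1+j≤1+m | tri> _ _ 1+t<1+j =
      subst (_∈ S ∪ ⁅ x ⁆) (sym (insertAt-above x g (s≤s⁻¹ 1+t<1+j)))
        (x∈p∪q⁺ (inj₁ (member en j (s≤s⁻¹ 1+j≤1+m))))
    onto′ : ∀ v → v ∈ S ∪ ⁅ x ⁆ → ∃ λ j → j ≤ suc m × h j ≡ v
    onto′ v v∈S∪x with x∈p∪q⁻ S ⁅ x ⁆ v∈S∪x
    ... | inj₂ v∈⁅x⁆ = suc t , s≤s (<⇒≤ t<m) , trans (insertAt-at x (suc t) g) (sym (x∈⁅y⁆⇒x≡y x v∈⁅x⁆))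
    ... | inj₁ v∈S with onto en v v∈S
    ...   | j , j≤m , gj≡v with insertAt-keeps x (suc t) g j
    ...     | J , J≤1+j , hJ≡gj = J , ≤-trans J≤1+j (s≤s j≤m) , trans hJ≡gj gj≡v

module _ {n m : ℕ} {h : ℕ → Fin n} {T : Subset n} (en : Enumerates (suc m) h T) where

  private
    distinct : ∀ {a b} → a < b → b ≤ suc m → h a ≢ h b
    distinct a<b b≤1+m eq = <-irrefl (cong toℕ eq) (ascending-< (ascending en) a<b b≤1+m)

  enumerates-init : Enumerates m h (T - h (suc m))
  enumerates-init = record
    { ascending = λ j j<m → ascending en j (m<n⇒m<1+n j<m)
    ; member    = λ j j≤m → x∈p∧x≢y⇒x∈p-y (member en j (m≤n⇒m≤1+n j≤m)) (distinct (s≤s j≤m) ≤-refl)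
    ; onto      = onto′
    }
    where
    onto′ : ∀ v → v ∈ T - h (suc m) → ∃ λ j → j ≤ m × h j ≡ v
    onto′ v v∈A with onto en v (p─q⊆p T _ v∈A)
    ... | j , j≤1+m , refl with m≤n⇒m<n∨m≡n j≤1+m
    ...   | inj₁ j<1+m = j , s≤s⁻¹ j<1+m , refl
    ...   | inj₂ refl  = contradiction v∈A x∉p-x

  enumerates-tail : Enumerates m (h ∘ suc) (T - h 0)
  enumerates-tail = record
    { ascending = λ j j<m → ascending en (suc j) (s≤s j<m)
    ; member    = λ j j≤m → x∈p∧x≢y⇒x∈p-y (member en (suc j) (s≤s j≤m)) (distinct (s≤s z≤n) (s≤s j≤m) ∘ sym)
    ; onto      = onto′
    }
    where
    onto′ : ∀ v → v ∈ T - h 0 → ∃ λ j → j ≤ m × h (suc j) ≡ v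
    onto′ v v∈B with onto en v (p─q⊆p T _ v∈B)
    ... | zero  , _       , refl = contradiction v∈B x∉p-x
    ... | suc j , 1+j≤1+m , refl = j , s≤s⁻¹ 1+j≤1+m , refl

-- Positions of the elements of S in increasing order, as naturals; unlike an
-- enumeration into Fin n this exists for every S, so it can be built by recursion on S.
record Positions {n} (S : Subset n) (f : ℕ → ℕ) : Set where
  field
    ascending : ∀ j → suc j < ∣ S ∣ → f j < f (suc j)
    member    : ∀ j → j < ∣ S ∣ → ∃ λ (v : Fin n) → toℕ v ≡ f j × v ∈ S
    onto      : ∀ v → v ∈ S → ∃ λ j → j < ∣ S ∣ × f j ≡ toℕ v

positions : ∀ {n} (S : Subset n) → ∃ (Positions S)
positions [] = (λ _ → 0) , record { ascending = λ _ () ; member = λ _ () ; onto = λ _ () }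
positions (outside ∷ S) with positions S
... | f , ps = suc ∘ f , record
  { ascending = λ j 1+j<∣S∣ → s≤s (Positions.ascending ps j 1+j<∣S∣)
  ; member    = λ j j<∣S∣ → let (v , v≡fj , v∈S) = Positions.member ps j j<∣S∣
                            in fsuc v , cong suc v≡fj , there v∈S
  ; onto      = λ { (fsuc v) (there v∈S) → let (j , j<∣S∣ , fj≡v) = Positions.onto ps v v∈S
                                            in j , j<∣S∣ , cong suc fj≡v }
  }
positions (inside ∷ S) with positions S
... | f , ps = f′ , record { ascending = ascending′ ; member = member′ ; onto = onto′ }
  where
  f′ : ℕ → ℕ
  f′ zero    = 0
  f′ (suc j) = suc (f j)
  ascending′ : ∀ j → suc j < suc ∣ S ∣ → f′ j < f′ (suc j)
  ascending′ zero    _         = s≤s z≤n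
  ascending′ (suc j) 2+j<1+∣S∣ = s≤s (Positions.ascending ps j (s≤s⁻¹ 2+j<1+∣S∣))
  member′ : ∀ j → j < suc ∣ S ∣ → ∃ λ v → toℕ v ≡ f′ j × v ∈ inside ∷ S
  member′ zero    _         = fzero , refl , here
  member′ (suc j) 1+j<1+∣S∣ = let (v , v≡fj , v∈S) = Positions.member ps j (s≤s⁻¹ 1+j<1+∣S∣)
                              in fsuc v , cong suc v≡fj , there v∈S
  onto′ : ∀ v → v ∈ inside ∷ S → ∃ λ j → j < suc ∣ S ∣ × f′ j ≡ toℕ v
  onto′ fzero    here        = 0 , s≤s z≤n , refl
  onto′ (fsuc v) (there v∈S) = let (j , j<∣S∣ , fj≡v) = Positions.onto ps v v∈S
                               in suc j , s≤s j<∣S∣ , cong suc fj≡v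

enumerate : ∀ {n m} (S : Subset (suc n)) → ∣ S ∣ ≡ suc m → ∃ λ g → Enumerates m g S
enumerate {n} {m} S ∣S∣≡1+m with positions S
... | f , ps = g , record { ascending = ascending′ ; member = member′ ; onto = onto′ }
  where
  g : ℕ → Fin (suc n)
  g j = f j mod suc n
  below-size : ∀ {j} → j ≤ m → j < ∣ S ∣
  below-size j≤m = subst (_ <_) (sym ∣S∣≡1+m) (s≤s j≤m)
  toℕ-g : ∀ j → j ≤ m → toℕ (g j) ≡ f j
  toℕ-g j j≤m with Positions.member ps j (below-size j≤m)
  ... | v , v≡fj , _ = trans (toℕ-fromℕ< _) (m<n⇒m%n≡m (subst (_< suc n) v≡fj (toℕ<n v)))
  ascending′ : Ascending m (toℕ ∘ g)
  ascending′ j j<m = subst₂ _<_ (sym (toℕ-g j (<⇒≤ j<m))) (sym (toℕ-g (suc j) j<m))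
                       (Positions.ascending ps j (below-size j<m))
  member′ : ∀ j → j ≤ m → g j ∈ S
  member′ j j≤m with Positions.member ps j (below-size j≤m)
  ... | v , v≡fj , v∈S = subst (_∈ S) (toℕ-injective (trans v≡fj (sym (toℕ-g j j≤m)))) v∈S
  onto′ : ∀ v → v ∈ S → ∃ λ j → j ≤ m × g j ≡ v
  onto′ v v∈S with Positions.onto ps v v∈S
  ... | j , j<∣S∣ , fj≡v = j , j≤m , toℕ-injective (trans (toℕ-g j j≤m) fj≡v)
    where j≤m = s≤s⁻¹ (subst (j <_) ∣S∣≡1+m j<∣S∣)

isImage-cong : ∀ {m n} {e e′ : Fin m → Fin n} {S} → (∀ j → e j ≡ e′ j) → IsImage e S → IsImage e′ S
isImage-cong e≗e′ (member , covers) =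
  (λ j → subst (_∈ _) (e≗e′ j) (member j)) ,
  (λ v v∈S → let (j , ej≡v) = covers v v∈S in j , trans (sym (e≗e′ j)) ej≡v)

module _ {n m : ℕ} (H : UniformHypergraph n (suc m))
  (intervals : ∀ a → a + suc m ≤ n → ∀ S → Interval a (suc m) S → Edge H S)
  (transitive : Transitive (suc m) (Edge H)) where

  enumerated-edge : ∀ {g S} → Enumerates m g S → ∣ S ∣ ≡ suc m → Edge H S
  enumerated-edge {g} en = <-rec P step (span m (toℕ ∘ g)) en refl
    where
    P : ℕ → Set
    P d = ∀ {g S} → Enumerates m g S → span m (toℕ ∘ g) ≡ d → ∣ S ∣ ≡ suc m → Edge H S

    step : ∀ d → (∀ {d′} → d′ < d → P d′) → P d
    step _ smaller {g} {S} en refl ∣S∣≡1+m with gap-or-tight (toℕ ∘ g) m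
    ... | inj₂ tight = let (interval , fits) = enumerated-interval en tight
                       in intervals _ fits S interval
    ... | inj₁ (t , t<m , gap) = transitive (λ j → h (toℕ j))
          (ascending⇒strictlyIncreasing (ascending enT)) A B
          (isImage-cong (λ j → cong h (sym (toℕ-inject₁ j))) (enumerates⇒isImage enA))
          (smaller shrinksA enA refl ∣A∣≡1+m)
          (enumerates⇒isImage enB) (smaller shrinksB enB refl ∣B∣≡1+m)
          S ∣S∣≡1+m (λ v v∈S → proj₂ (enumerates⇒isImage enT) v (x∈p∪q⁺ (inj₁ v∈S)))
      where
      -- x = g t + 1 fills the gap after position t.
      x : Fin n
      x = fromℕ< (<-trans gap (toℕ<n (g (suc t))))
      below : toℕ (g t) < toℕ x
      below = ≤-reflexive (sym (toℕ-fromℕ< _))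
      above : toℕ x < toℕ (g (suc t))
      above = subst (_< toℕ (g (suc t))) (sym (toℕ-fromℕ< _)) gap
      h = insertAt (suc t) x g
      T = S ∪ ⁅ x ⁆
      enT : Enumerates (suc m) h T
      enT = enumerates-insert en t<m below above
      A = T - h (suc m)
      B = T - h 0
      enA = enumerates-init enT
      enB = enumerates-tail enT
      ∣T∣≡2+m : ∣ T ∣ ≡ suc (suc m)
      ∣T∣≡2+m = trans (size-add S (between-not-member en t<m below above)) (cong suc ∣S∣≡1+m)
      ∣A∣≡1+m : ∣ A ∣ ≡ suc m
      ∣A∣≡1+m = suc-injective (trans (size-remove T (member enT (suc m) ≤-refl)) ∣T∣≡2+m)
      ∣B∣≡1+m : ∣ B ∣ ≡ suc m
      ∣B∣≡1+m = suc-injective (trans (size-remove T (member enT 0 z≤n)) ∣T∣≡2+m)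
      -- Insertion keeps both endpoints, hence the span.
      same-span : span (suc m) (toℕ ∘ h) ≡ span m (toℕ ∘ g)
      same-span = cong (λ v → toℕ v ∸ toℕ (g 0)) (insertAt-above x g t<m)
      shrinksA : span m (toℕ ∘ h) < span m (toℕ ∘ g)
      shrinksA = subst (span m (toℕ ∘ h) <_) same-span (span-init (ascending enT))
      shrinksB : span m (toℕ ∘ h ∘ suc) < span m (toℕ ∘ g)
      shrinksB = subst (span m (toℕ ∘ h ∘ suc) <_) same-span (span-tail (ascending enT))

lemma8 : ∀ (n k : ℕ) → 1 ≤ k → k < n → (H : UniformHypergraph n k) →
    (∀ (a : ℕ) → a + k ≤ n → ∀ (S : Subset n) → Interval a k S → Edge H S) →
    Transitive k (Edge H) → Complete H
lemma8 zero    _       _  ()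
lemma8 (suc n) zero    () _
lemma8 (suc n) (suc m) _ _ H intervals transitive S ∣S∣≡k =
  enumerated-edge H intervals transitive (proj₂ (enumerate S ∣S∣≡k)) ∣S∣≡k
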